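{- Every Gauss sequence is an Euler–Gauss sequence. That is, if an integer sequence $(a_n)_{n\ge1}$ satisfies $\sum_{d\mid n}\mu(d)\,a_{n/d}\equiv 0 \pmod n$ for all $n\ge1$, then it satisfies $A_n^+\equiv A_n^-\pmod n$ for all $n\ge 1$, where $A_n^+=\prod_{d\mid n,\ \mu(d)=1} a_{n/d}$ and $A_n^-=\prod_{d\mid n,\ \mu(d)=-1} a_{n/d}$.
   Context: $\mu$ is the Möbius function. An integer sequence is a Gauss sequence if $\sum_{d\mid n}\mu(d)a_{n/d}\equiv0\pmod n$ for all $n\ge1$; it is an Euler–Gauss sequence if $A_n^+\equiv A_n^-\pmod n$ for all $n\ge1$ with $A_n^\pm$ as in the claim (an empty product equals $1$). -}

module Defs where

open import Data.Nat as ℕ using (ℕ; zero; suc; _/_; _≤_)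
open import Data.Nat.Divisibility as ℕD using (_∣?_)
open import Data.Integer as ℤ using (ℤ; +_; -_; _-_; 0ℤ; 1ℤ)
open import Data.Integer.Divisibility as ℤD using ()
open import Data.List using (List; filter; map; upTo; foldr)
open import Relation.Nullary using (yes; no)

-- n div d (truncated), with the irrelevant convention n div 0 = 0
_div_ : ℕ → ℕ → ℕ
n div zero = 0
n div (suc k) = n / suc k

sumℤ : List ℤ → ℤ
sumℤ = foldr ℤ._+_ 0ℤ

productℤ : List ℤ → ℤ
productℤ = foldr ℤ._*_ 1ℤ

-- Möbius function, defined by trial division.
-- mobiusAux fuel n d : assuming every prime factor of n is ≥ d,
-- returns μ(n).  The first d ≥ 2 with d ∣ n is the least prime factor p;
-- if p² ∣ n then μ(n) = 0, else μ(n) = - μ(n / p).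
mobiusAux : ℕ → ℕ → ℕ → ℤ
mobiusAux zero    n d = 1ℤ
mobiusAux (suc f) 0 d = 0ℤ          -- μ(0) is irrelevant; fixed as 0
mobiusAux (suc f) 1 d = 1ℤ
mobiusAux (suc f) n@(suc (suc _)) 0 = mobiusAux f n 2
mobiusAux (suc f) n@(suc (suc _)) 1 = mobiusAux f n 2
mobiusAux (suc f) n@(suc (suc _)) d@(suc (suc k)) with d ∣? n
... | no  _ = mobiusAux f n (suc d)
... | yes _ with (d ℕ.* d) ∣? n
...   | yes _ = 0ℤ
...   | no  _ = - mobiusAux f (n / d) (suc d)

-- μ(n); fuel 2 * n + 2 is more than enough (each step either increases d ≤ n
-- or divides n).
μ : ℕ → ℤ
μ n = mobiusAux (2 ℕ.* n ℕ.+ 2) n 2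

divisors : ℕ → List ℕ
divisors n = filter (_∣? n) (map suc (upTo n))

_≡_[mod_] : ℤ → ℤ → ℕ → Set
x ≡ y [mod n ] = (+ n) ℤD.∣ (x - y)

-- Gauss sequence (indexing a : ℕ → ℤ; only a 1, a 2, … are used)
IsGauss : (ℕ → ℤ) → Set
IsGauss a = ∀ n → 1 ≤ n →
  sumℤ (map (λ d → μ d ℤ.* a (n div d)) (divisors n)) ≡ 0ℤ [mod n ]

Aplus : (ℕ → ℤ) → ℕ → ℤ
Aplus a n = productℤ (map (λ d → a (n div d)) (filter (λ d → μ d ℤ.≟ 1ℤ) (divisors n)))

Aminus : (ℕ → ℤ) → ℕ → ℤ
Aminus a n = productℤ (map (λ d → a (n div d)) (filter (λ d → μ d ℤ.≟ - 1ℤ) (divisors n)))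

IsEulerGauss : (ℕ → ℤ) → Set
IsEulerGauss a = ∀ n → 1 ≤ n → Aplus a n ≡ Aminus a n [mod n ]

-- It suffices to prove A⁺ₙ ≡ A⁻ₙ modulo every prime power p ^ k dividing n.  For p ∣ N the
-- map e ↦ p e sends the divisors e of N with μ e ≠ 0 and p ∤ e bijectively onto those with
-- μ d ≠ 0 and p ∣ d, and μ (p e) = - μ e.  Pairing e with p e therefore rewrites the Gauss
-- sum of N as  Σₑ μ e (a (N / e) - a (N / p e)).  By strong induction on N, every term with
-- e ≠ 1 vanishes modulo p ^ k when p ^ k ∣ N, hence so does the term  a N - a (N / p).
-- The same pairing matches each factor a (n / e) of one of A⁺ₙ, A⁻ₙ with the factor
-- a (n / p e) of the other, and these are congruent modulo p ^ k.
module Submission where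

open import Defs
open import Data.Nat using (ℕ)
open import Data.Integer using (ℤ)

open import Algebra.Bundles using (CommutativeMonoid)
open import Data.Integer as ℤ using (+_; -_; 0ℤ; 1ℤ)
import Data.Integer.Divisibility.Signed as S
open S using () renaming (_∣_ to _∣ℤ_)
import Data.Integer.Properties as ℤ
open import Data.Integer.Tactic.RingSolver using (solve-∀)
open import Data.List.Base using (List; []; _∷_; map; filter; foldr; upTo)
open import Data.List.Membership.Propositional using (_∈_)
open import Data.List.Membership.Propositional.Properties
  using (∈-filter⁺; ∈-filter⁻; ∈-map⁺; ∈-map⁻; ∈-upTo⁺)
open import Data.List.Membership.Propositional.Properties.WithK using (unique∧set⇒bag)
open import Data.List.Properties using (map-∘)
open import Data.List.Relation.Binary.BagAndSetEquality using (∼bag⇒↭)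
open import Data.List.Relation.Binary.Permutation.Propositional using (_↭_; ↭-sym; ↭⇒↭ₛ′)
open import Data.List.Relation.Binary.Permutation.Propositional.Properties using (map⁺)
open import Data.List.Relation.Binary.Permutation.Setoid.Properties using (foldr-commMonoid)
import Data.List.Relation.Unary.All as All
open import Data.List.Relation.Unary.AllPairs using (_∷_)
open import Data.List.Relation.Unary.Any using (here; there)
open import Data.List.Relation.Unary.Unique.Propositional using (Unique)
import Data.List.Relation.Unary.Unique.Propositional.Properties as Unique
open import Data.Nat.Base
  using (zero; suc; 2+; z<s; _+_; _*_; _/_; _^_; _≤_; _<_; z≤n; s≤s
        ; NonZero; >-nonZero; >-nonZero⁻¹; n>1⇒nonTrivial; nonTrivial⇒n>1)
open import Data.Nat.Divisibility
open import Data.Nat.DivMod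
  using (m/n/o≡m/[n*o]; /-congʳ; n/1≡n; *-/-assoc; m*[n/m]≡n; m*n/n≡m; m/n≤m; m/n<m; m≥n⇒m/n>0)
open import Data.Nat.Induction using (<-wellFounded)
open import Data.Nat.Primality
open import Data.Nat.Properties
import Algebra.Properties.CommutativeSemigroup *-commutativeSemigroup as ℕ*
open import Data.Product using (Σ; _×_; _,_)
open import Data.Sum using (inj₁; inj₂)
open import Function.Base using (id; _∘′_)
open import Function.Bundles using (_⇔_; mk⇔; Equivalence)
open import Induction.WellFounded using (Acc; acc)
open import Level using (0ℓ)
open import Relation.Binary.Definitions using (tri<; tri≈; tri>)
open import Relation.Binary.PropositionalEquality
  using (_≡_; _≢_; refl; sym; trans; cong; cong₂; subst; module ≡-Reasoning)
import Relation.Binary.Reasoning.Setoid as ≈-Reasoning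
open import Relation.Nullary using (yes; no; contradiction)
open import Relation.Unary using (Pred; Decidable)
open import Relation.Unary.Properties using (∁?)

private
  variable
    d d′ e f f′ m n p q q′ r : ℕ

div≡/ : ∀ m n .{{_ : NonZero n}} → m div n ≡ m / n
div≡/ m (suc n) = refl

module _ {n d : ℕ} .{{_ : NonZero n}} .{{_ : NonZero d}} where

  div-nonZero : d ∣ n → NonZero (n div d)
  div-nonZero d∣n = >-nonZero (subst (0 <_) (sym (div≡/ n d)) (m≥n⇒m/n>0 (∣⇒≤ d∣n)))

  div-< : d ≢ 1 → n div d < n
  div-< d≢1 = subst (_< n) (sym (div≡/ n d)) (m/n<m n d (≤∧≢⇒< (>-nonZero⁻¹ d) (d≢1 ∘′ sym)))

div-cancel : .{{_ : NonZero d}} → d ∣ n → d * (n div d) ≡ n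
div-cancel {d} {n} d∣n = trans (cong (d *_) (div≡/ n d)) (m*[n/m]≡n d∣n)

div-div : ∀ n d e .{{_ : NonZero d}} .{{_ : NonZero e}} → (n div d) div e ≡ n div (e * d)
div-div n d e = begin
  (n div d) div e ≡⟨ div≡/ (n div d) e ⟩
  (n div d) / e   ≡⟨ cong (_/ e) (div≡/ n d) ⟩
  n / d / e       ≡⟨ m/n/o≡m/[n*o] n d e ⟩
  n / (d * e)     ≡⟨ /-congʳ (*-comm d e) ⟩
  n / (e * d)     ≡⟨ div≡/ n (e * d) ⟨
  n div (e * d)   ∎
  where
  open ≡-Reasoning
  instance
    d*e≢0 : NonZero (d * e)
    d*e≢0 = m*n≢0 d e
    e*d≢0 : NonZero (e * d)
    e*d≢0 = m*n≢0 e d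

prime≥2 : Prime p → 2 ≤ p
prime≥2 {p} pp = nonTrivial⇒n>1 p {{prime⇒nonTrivial pp}}

distinctPrimes⇒∤ : Prime p → Prime q → p ≢ q → p ∤ q
distinctPrimes⇒∤ pp pq p≢q p∣q with prime⇒irreducible pq p∣q
... | inj₁ refl = ¬prime[1] pp
... | inj₂ p≡q  = p≢q p≡q

primePower-divisor : Prime p → p ∤ m → ∀ k → p ^ k ∣ m * n → p ^ k ∣ n
primePower-divisor pp p∤m zero _ = 1∣ _
primePower-divisor {p} {m} {n} pp p∤m (suc k) pᵏ⁺¹∣mn
  with euclidsLemma m n pp (m*n∣⇒m∣ p (p ^ k) pᵏ⁺¹∣mn)
... | inj₁ p∣m = contradiction p∣m p∤m
... | inj₂ (divides n′ refl) = subst (p ^ suc k ∣_) (*-comm p n′)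
  (*-monoʳ-∣ p (primePower-divisor pp p∤m k (*-cancelˡ-∣ p {{prime⇒nonZero pp}} p*pᵏ∣p*mn′)))
  where
  p*pᵏ∣p*mn′ : p * p ^ k ∣ p * (m * n′)
  p*pᵏ∣p*mn′ = subst (p ^ suc k ∣_) (ℕ*.x∙yz≈z∙xy m n′ p) pᵏ⁺¹∣mn

primeSquare-divisor : Prime p → p ∤ m → p * p ∣ m * n → p * p ∣ n
primeSquare-divisor {p} {m} {n} pp p∤m p*p∣mn =
  subst (_∣ n) p²≡p*p (primePower-divisor pp p∤m 2 (subst (_∣ m * n) (sym p²≡p*p) p*p∣mn))
  where p²≡p*p = cong (p *_) (*-identityʳ p)

primePower-∣-div : ∀ k .{{_ : NonZero d}} → Prime p → p ∤ d → d ∣ n → p ^ k ∣ n → p ^ k ∣ n div d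
primePower-∣-div {d} {p} k pp p∤d d∣n pᵏ∣n =
  primePower-divisor pp p∤d k (subst (p ^ k ∣_) (sym (div-cancel d∣n)) pᵏ∣n)

p*e∣n : Prime p → p ∣ n → e ∣ n → p ∤ e → p * e ∣ n
p*e∣n {p} {n} {e} pp p∣n (divides c refl) p∤e with euclidsLemma c e pp p∣n
... | inj₁ (divides c′ refl) = divides c′ (*-assoc c′ p e)
... | inj₂ p∣e = contradiction p∣e p∤e

-- The Möbius function

record LeastDivisor (q n : ℕ) : Set where
  constructor leastDivisor
  field
    2≤q   : 2 ≤ q
    q∣n   : q ∣ n
    rough : q Rough n

leastDivisor-unique : LeastDivisor q n → LeastDivisor q′ n → q ≡ q′
leastDivisor-unique {q} {n} {q′} (leastDivisor 2≤q q∣n rough) (leastDivisor 2≤q′ q′∣n rough′)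
  with <-cmp q q′
... | tri< q<q′ _ _ = contradiction (hasNonTrivialDivisor {{n>1⇒nonTrivial 2≤q}} q<q′ q∣n) rough′
... | tri≈ _ q≡q′ _ = q≡q′
... | tri> _ _ q′<q = contradiction (hasNonTrivialDivisor {{n>1⇒nonTrivial 2≤q′}} q′<q q′∣n) rough

leastDivisor⇒prime : LeastDivisor q n → Prime q
leastDivisor⇒prime (leastDivisor 2≤q q∣n rough) = rough∧∣⇒prime {{n>1⇒nonTrivial 2≤q}} rough q∣n

leastDivisor⇒nonZero : LeastDivisor q n → NonZero q
leastDivisor⇒nonZero ld = >-nonZero (<-trans z<s (LeastDivisor.2≤q ld))

-- Invariant of a call  mobiusAux f n d : n has no nontrivial divisor below d ≥ 2, and the
-- fuel f cannot run out, as every step increases d or replaces n by a proper divisor.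
Adequate : ℕ → ℕ → ℕ → Set
Adequate f n d = 2 ≤ d × d Rough n × n + 2 ≤ f + d

adequate-μ : ∀ n → Adequate (2 * n + 2) n 2
adequate-μ n = ≤-refl , 2-rough , +-monoˡ-≤ 2 (≤-trans (m≤m+n n (n + 0)) (m≤m+n (2 * n) 2))

module _ {q n : ℕ} (ld : LeastDivisor q n) where
  open LeastDivisor ld

  private instance
    q≢0 : NonZero q
    q≢0 = leastDivisor⇒nonZero ld

  leastDivisor-2≤ : .{{NonZero n}} → 2 ≤ n
  leastDivisor-2≤ = ≤-trans 2≤q (∣⇒≤ q∣n)

  leastDivisor-div< : .{{NonZero n}} → n div q < n
  leastDivisor-div< = div-< λ q≡1 → contradiction (subst (2 ≤_) q≡1 2≤q) λ { (s≤s ()) }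

  leastDivisor-div≢0 : .{{NonZero n}} → NonZero (n div q)
  leastDivisor-div≢0 = div-nonZero q∣n

  adequate-div : q * q ∤ n → Adequate (suc f) n q → Adequate f (n div q) (suc q)
  adequate-div {f} q²∤n (_ , _ , fuel) rewrite div≡/ n q {{q≢0}} =
    m≤n⇒m≤1+n 2≤q ,
    ∤⇒rough-suc (q²∤n ∘′ m∣n/o⇒m*o∣n q∣n) (rough∧∣⇒rough rough (m/n∣m q∣n)) ,
    ≤-trans (+-monoˡ-≤ 2 (m/n≤m n q)) (subst (n + 2 ≤_) (sym (+-suc f q)) fuel)

mobiusAux-1 : ∀ f d → mobiusAux f 1 d ≡ 1ℤ
mobiusAux-1 zero    d = refl
mobiusAux-1 (suc f) d = refl

mobiusAux-skip : ∀ f → 2 ≤ n → 2 ≤ d → d ∤ n → mobiusAux (suc f) n d ≡ mobiusAux f n (suc d)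
mobiusAux-skip {n} {d} f (s≤s (s≤s _)) (s≤s (s≤s _)) d∤n with d ∣? n
... | yes d∣n = contradiction d∣n d∤n
... | no _    = refl

mobiusAux-square : ∀ f → 2 ≤ n → 2 ≤ d → d ∣ n → d * d ∣ n → mobiusAux (suc f) n d ≡ 0ℤ
mobiusAux-square {n} {d} f (s≤s (s≤s _)) (s≤s (s≤s _)) d∣n d²∣n with d ∣? n
... | no d∤n = contradiction d∣n d∤n
... | yes _ with d * d ∣? n
...   | no d²∤n = contradiction d²∣n d²∤n
...   | yes _   = refl

mobiusAux-squarefree : ∀ f → 2 ≤ n → 2 ≤ d → d ∣ n → d * d ∤ n →
                       mobiusAux (suc f) n d ≡ - mobiusAux f (n div d) (suc d)
mobiusAux-squarefree {n} {d} f (s≤s (s≤s _)) (s≤s (s≤s _)) d∣n d²∤n with d ∣? n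
... | no d∤n = contradiction d∣n d∤n
... | yes _ with d * d ∣? n
...   | yes d²∣n = contradiction d²∣n d²∤n
...   | no _     = refl

mobiusAux-reaches-leastDivisor : ∀ f → 2 ≤ n → Adequate f n d →
  Σ ℕ λ q → Σ ℕ λ f′ → LeastDivisor q n × Adequate (suc f′) n q × mobiusAux f n d ≡ mobiusAux (suc f′) n q
mobiusAux-reaches-leastDivisor {n} zero 2≤n (_ , rough , n+2≤d) =
  contradiction (hasNonTrivialDivisor {{n>1⇒nonTrivial 2≤n}} (<-≤-trans (m<m+n n z<s) n+2≤d) ∣-refl) rough
mobiusAux-reaches-leastDivisor {n} {d} (suc f) 2≤n adq@(2≤d , rough , fuel) with d ∣? n
... | yes d∣n = d , f , leastDivisor 2≤d d∣n rough , adq , refl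
... | no d∤n with mobiusAux-reaches-leastDivisor f 2≤n
                    (m≤n⇒m≤1+n 2≤d , ∤⇒rough-suc d∤n rough , subst (n + 2 ≤_) (sym (+-suc f d)) fuel)
...   | q , f′ , ld , adq′ , run≡ = q , f′ , ld , adq′ , trans (mobiusAux-skip f 2≤n 2≤d d∤n) run≡

-- Both runs reach the least divisor q of n, where they either both stop with 0 or both
-- continue with a run on n / q.
mobiusAux-adequate-agree : Acc _<_ n → .{{NonZero n}} → Adequate f n d → Adequate f′ n d′ →
                           mobiusAux f n d ≡ mobiusAux f′ n d′
mobiusAux-adequate-agree {1} {f} {d} {f′} {d′} _ _ _ = trans (mobiusAux-1 f d) (sym (mobiusAux-1 f′ d′))
mobiusAux-adequate-agree {n@(2+ _)} {f} {d} {f′} {d′} (acc rs) adq adq′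
  with mobiusAux-reaches-leastDivisor f 2≤n adq | mobiusAux-reaches-leastDivisor f′ 2≤n adq′
  where 2≤n = s≤s (s≤s z≤n)
... | q , g , ld@(leastDivisor 2≤q q∣n _) , adqq , run≡ | _ , g′ , ld′ , adqq′ , run≡′
  with leastDivisor-unique ld ld′
... | refl with q * q ∣? n
... | yes q²∣n = begin
  mobiusAux f n d        ≡⟨ run≡ ⟩
  mobiusAux (suc g) n q  ≡⟨ mobiusAux-square g (leastDivisor-2≤ ld) 2≤q q∣n q²∣n ⟩
  0ℤ                     ≡⟨ mobiusAux-square g′ (leastDivisor-2≤ ld) 2≤q q∣n q²∣n ⟨
  mobiusAux (suc g′) n q ≡⟨ run≡′ ⟨
  mobiusAux f′ n d′      ∎
  where open ≡-Reasoning
... | no q²∤n = begin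
  mobiusAux f n d                  ≡⟨ run≡ ⟩
  mobiusAux (suc g) n q            ≡⟨ mobiusAux-squarefree g (leastDivisor-2≤ ld) 2≤q q∣n q²∤n ⟩
  - mobiusAux g (n div q) (suc q)  ≡⟨ cong -_ (mobiusAux-adequate-agree (rs (leastDivisor-div< ld))
                                        {{leastDivisor-div≢0 ld}} (adequate-div ld q²∤n adqq) (adequate-div ld q²∤n adqq′)) ⟩
  - mobiusAux g′ (n div q) (suc q) ≡⟨ mobiusAux-squarefree g′ (leastDivisor-2≤ ld) 2≤q q∣n q²∤n ⟨
  mobiusAux (suc g′) n q           ≡⟨ run≡′ ⟨
  mobiusAux f′ n d′                ∎
  where open ≡-Reasoning

mobiusAux-adequate : .{{NonZero n}} → Adequate f n d → mobiusAux f n d ≡ μ n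
mobiusAux-adequate {n} adq = mobiusAux-adequate-agree (<-wellFounded n) adq (adequate-μ n)

leastDivisor-exists : 2 ≤ n → Σ ℕ λ q → LeastDivisor q n
leastDivisor-exists {n} 2≤n with mobiusAux-reaches-leastDivisor _ 2≤n (adequate-μ n)
... | q , _ , ld , _ = q , ld

μ-reaches-leastDivisor : .{{NonZero n}} → LeastDivisor q n →
                         Σ ℕ λ f → Adequate (suc f) n q × μ n ≡ mobiusAux (suc f) n q
μ-reaches-leastDivisor {n} ld with mobiusAux-reaches-leastDivisor _ (leastDivisor-2≤ ld) (adequate-μ n)
... | _ , f , ld′ , adq , μ≡ with leastDivisor-unique ld ld′
... | refl = f , adq , μ≡

μ-leastDivisor-square : .{{NonZero n}} → LeastDivisor q n → q * q ∣ n → μ n ≡ 0ℤ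
μ-leastDivisor-square ld@(leastDivisor 2≤q q∣n _) q²∣n with μ-reaches-leastDivisor ld
... | f , _ , μ≡ = trans μ≡ (mobiusAux-square f (leastDivisor-2≤ ld) 2≤q q∣n q²∣n)

μ-leastDivisor-squarefree : .{{NonZero n}} → LeastDivisor q n → q * q ∤ n → μ n ≡ - μ (n div q)
μ-leastDivisor-squarefree {n} {q} ld@(leastDivisor 2≤q q∣n _) q²∤n with μ-reaches-leastDivisor ld
... | f , adq , μ≡ = begin
  μ n                             ≡⟨ μ≡ ⟩
  mobiusAux (suc f) n q           ≡⟨ mobiusAux-squarefree f (leastDivisor-2≤ ld) 2≤q q∣n q²∤n ⟩
  - mobiusAux f (n div q) (suc q) ≡⟨ cong -_ (mobiusAux-adequate {{leastDivisor-div≢0 ld}} (adequate-div ld q²∤n adq)) ⟩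
  - μ (n div q)                   ∎
  where open ≡-Reasoning

μ-square : Prime p → .{{NonZero n}} → p * p ∣ n → μ n ≡ 0ℤ
μ-square {p} {n} pp = go (<-wellFounded n)
  where
  go : ∀ {n} → Acc _<_ n → .{{NonZero n}} → p * p ∣ n → μ n ≡ 0ℤ
  go {n} (acc rs) p²∣n with leastDivisor-exists (≤-trans (prime≥2 pp) p≤n)
    where p≤n = ≤-trans (m≤m*n p p {{prime⇒nonZero pp}}) (∣⇒≤ p²∣n)
  ... | q , ld with q * q ∣? n
  ...   | yes q²∣n = μ-leastDivisor-square ld q²∣n
  ...   | no q²∤n =
    trans (μ-leastDivisor-squarefree ld q²∤n) (cong -_ (go (rs (leastDivisor-div< ld)) {{leastDivisor-div≢0 ld}} p²∣n/q))
    where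
    p²∣n/q : p * p ∣ n div q
    p²∣n/q = primeSquare-divisor pp (distinctPrimes⇒∤ pp (leastDivisor⇒prime ld) λ { refl → q²∤n p²∣n })
      (subst (p * p ∣_) (sym (div-cancel {{leastDivisor⇒nonZero ld}} (LeastDivisor.q∣n ld))) p²∣n)

μ-p* : Prime p → .{{NonZero e}} → p ∤ e → μ (p * e) ≡ - μ e
μ-p* {p} {e} pp = go (<-wellFounded e)
  where
  instance
    p≢0 : NonZero p
    p≢0 = prime⇒nonZero pp
    p*≢0 : ∀ {e} → .{{NonZero e}} → NonZero (p * e)
    p*≢0 {e} = m*n≢0 p e

  go : ∀ {e} → Acc _<_ e → .{{NonZero e}} → p ∤ e → μ (p * e) ≡ - μ e
  go {e} (acc rs) p∤e with leastDivisor-exists (≤-trans (prime≥2 pp) (m≤m*n p e))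
  ... | q , ld@(leastDivisor 2≤q q∣pe rough) with q * q ∣? p * e | q ≟ p
  ...   | yes q²∣pe | _ = trans (μ-leastDivisor-square ld q²∣pe) (sym (cong -_ (μ-square qp q²∣e)))
    where
    qp = leastDivisor⇒prime ld
    q²∣e : q * q ∣ e
    q²∣e = primeSquare-divisor qp (distinctPrimes⇒∤ qp pp λ { refl → p∤e (*-cancelˡ-∣ p q²∣pe) }) q²∣pe
  ...   | no q²∤pe | yes refl = trans (μ-leastDivisor-squarefree ld q²∤pe) (cong (λ x → - μ x) pe/p≡e)
    where
    pe/p≡e : (p * e) div p ≡ e
    pe/p≡e = trans (div≡/ (p * e) p) (trans (cong (_/ p) (*-comm p e)) (m*n/n≡m e p))
  ...   | no q²∤pe | no q≢p = begin
    μ (p * e)           ≡⟨ μ-leastDivisor-squarefree ld q²∤pe ⟩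
    - μ ((p * e) div q) ≡⟨ cong (λ x → - μ x) pe/q≡p[e/q] ⟩
    - μ (p * (e div q)) ≡⟨ cong -_ (go (rs (leastDivisor-div< ldₑ)) {{leastDivisor-div≢0 ldₑ}} p∤e/q) ⟩
    - - μ (e div q)     ≡⟨ cong -_ (μ-leastDivisor-squarefree ldₑ (q²∤pe ∘′ ∣n⇒∣m*n p)) ⟨
    - μ e               ∎
    where
    open ≡-Reasoning
    instance
      q≢0 : NonZero q
      q≢0 = leastDivisor⇒nonZero ld
    q∣e : q ∣ e
    q∣e with euclidsLemma p e (leastDivisor⇒prime ld) q∣pe
    ... | inj₁ q∣p = contradiction q∣p (distinctPrimes⇒∤ (leastDivisor⇒prime ld) pp q≢p)
    ... | inj₂ q∣e = q∣e
    ldₑ : LeastDivisor q e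
    ldₑ = leastDivisor 2≤q q∣e (rough∧∣⇒rough rough (n∣m*n p))
    pe/q≡p[e/q] : (p * e) div q ≡ p * (e div q)
    pe/q≡p[e/q] = trans (div≡/ (p * e) q) (trans (*-/-assoc p q∣e) (cong (p *_) (sym (div≡/ e q))))
    p∤e/q : p ∤ e div q
    p∤e/q p∣e/q = p∤e (∣-trans p∣e/q (subst (_∣ e) (sym (div≡/ e q)) (m/n∣m q∣e)))

μ-p*-≡ : Prime p → .{{NonZero e}} → p ∤ e → ∀ s → μ e ≡ s ⇔ μ (p * e) ≡ - s
μ-p*-≡ pp p∤e s = mk⇔ (λ μe≡s → trans (μ-p* pp p∤e) (cong -_ μe≡s))
                      (λ μpe≡-s → ℤ.neg-injective (trans (sym (μ-p* pp p∤e)) μpe≡-s))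

module Fold {c ℓ} (M : CommutativeMonoid c ℓ) where
  open CommutativeMonoid M renaming (refl to ≈-refl; sym to ≈-sym; trans to ≈-trans)
  open import Algebra.Properties.CommutativeSemigroup commutativeSemigroup
    using (interchange; x∙yz≈y∙xz)
  open ≈-Reasoning setoid

  fold : List Carrier → Carrier
  fold = foldr _∙_ ε

  fold-↭ : ∀ {xs ys} → xs ↭ ys → fold xs ≈ fold ys
  fold-↭ = foldr-commMonoid setoid isCommutativeMonoid ∘′ ↭⇒↭ₛ′ isEquivalence

  module _ {a} {A : Set a} where

    fold-map-∙ : ∀ (g h : A → Carrier) xs →
                 fold (map (λ x → g x ∙ h x) xs) ≈ fold (map g xs) ∙ fold (map h xs)
    fold-map-∙ g h []       = ≈-sym (identityˡ ε)
    fold-map-∙ g h (x ∷ xs) = begin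
      (g x ∙ h x) ∙ fold (map (λ x → g x ∙ h x) xs)     ≈⟨ ∙-congˡ (fold-map-∙ g h xs) ⟩
      (g x ∙ h x) ∙ (fold (map g xs) ∙ fold (map h xs)) ≈⟨ interchange (g x) (h x) _ _ ⟩
      (g x ∙ fold (map g xs)) ∙ (h x ∙ fold (map h xs)) ∎

    fold-filter-ε : ∀ {p} {P : Pred A p} (P? : Decidable P) (g : A → Carrier) xs →
                    (∀ {x} → P x → g x ≈ ε) → fold (map g (filter (∁? P?) xs)) ≈ fold (map g xs)
    fold-filter-ε P? g [] _ = ≈-refl
    fold-filter-ε P? g (x ∷ xs) g≈ε with P? x
    ... | no _   = ∙-congˡ (fold-filter-ε P? g xs g≈ε)
    ... | yes px = begin
      fold (map g (filter (∁? P?) xs)) ≈⟨ fold-filter-ε P? g xs g≈ε ⟩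
      fold (map g xs)                  ≈⟨ identityˡ _ ⟨
      ε ∙ fold (map g xs)              ≈⟨ ∙-congʳ (g≈ε px) ⟨
      g x ∙ fold (map g xs)            ∎

    fold-partition : ∀ {p} {P : Pred A p} (P? : Decidable P) (g : A → Carrier) xs →
      fold (map g xs) ≈ fold (map g (filter P? xs)) ∙ fold (map g (filter (∁? P?) xs))
    fold-partition P? g [] = ≈-sym (identityˡ ε)
    fold-partition P? g (x ∷ xs) with P? x
    ... | yes _ = ≈-trans (∙-congˡ (fold-partition P? g xs)) (≈-sym (assoc _ _ _))
    ... | no _  = ≈-trans (∙-congˡ (fold-partition P? g xs)) (x∙yz≈y∙xz _ _ _)

    fold-partition-reindex : ∀ {p} {P : Pred A p} (P? : Decidable P) (g : A → Carrier) (σ : A → A) xs ys →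
      map σ ys ↭ filter P? xs →
      fold (map g xs) ≈ fold (map (g ∘′ σ) ys) ∙ fold (map g (filter (∁? P?) xs))
    fold-partition-reindex P? g σ xs ys σys↭ = begin
      fold (map g xs)                                                ≈⟨ fold-partition P? g xs ⟩
      fold (map g (filter P? xs)) ∙ fold (map g (filter (∁? P?) xs)) ≈⟨ ∙-congʳ (fold-↭ (map⁺ g (↭-sym σys↭))) ⟩
      fold (map g (map σ ys)) ∙ fold (map g (filter (∁? P?) xs))     ≡⟨ cong (λ zs → fold zs ∙ _) (map-∘ ys) ⟨
      fold (map (g ∘′ σ) ys) ∙ fold (map g (filter (∁? P?) xs))      ∎

module Sumℤ     = Fold ℤ.+-0-commutativeMonoid
module Productℤ = Fold ℤ.*-1-commutativeMonoid

∈-divisors⁺ : .{{NonZero n}} → .{{NonZero d}} → d ∣ n → d ∈ divisors n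
∈-divisors⁺ {n} {suc d} d∣n = ∈-filter⁺ (_∣? n) (∈-map⁺ suc (∈-upTo⁺ (∣⇒≤ d∣n))) d∣n

∈-divisors⁻ : d ∈ divisors n → NonZero d × d ∣ n
∈-divisors⁻ {d} {n} d∈ with ∈-filter⁻ (_∣? n) {xs = map suc (upTo n)} d∈
... | d∈suc , d∣n with ∈-map⁻ suc d∈suc
...   | _ , _ , refl = _ , d∣n

divisors-unique : ∀ n → Unique (divisors n)
divisors-unique n = Unique.filter⁺ (_∣? n) (Unique.map⁺ suc-injective (Unique.upTo⁺ n))

divisorsWith : {Q : Pred ℕ 0ℓ} → Decidable Q → ℕ → List ℕ
divisorsWith Q? n = filter Q? (divisors n)

p-free : ℕ → {Q : Pred ℕ 0ℓ} → Decidable Q → ℕ → List ℕ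
p-free p Q? n = filter (∁? (p ∣?_)) (divisorsWith Q? n)

module _ {Q : Pred ℕ 0ℓ} (Q? : Decidable Q) where

  p-free-unique : Unique (p-free p Q? n)
  p-free-unique {p} {n} = Unique.filter⁺ (∁? (p ∣?_)) (Unique.filter⁺ Q? (divisors-unique n))

  ∈-p-free⁺ : .{{NonZero n}} → .{{NonZero e}} → e ∣ n → Q e → p ∤ e → e ∈ p-free p Q? n
  ∈-p-free⁺ {p = p} e∣n Qe p∤e = ∈-filter⁺ (∁? (p ∣?_)) (∈-filter⁺ Q? (∈-divisors⁺ e∣n) Qe) p∤e

  ∈-p-free⁻ : e ∈ p-free p Q? n → (NonZero e × e ∣ n) × Q e × p ∤ e
  ∈-p-free⁻ {e} {p} {n} e∈ with ∈-filter⁻ (∁? (p ∣?_)) {xs = divisorsWith Q? n} e∈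
  ... | e∈Q , p∤e with ∈-filter⁻ Q? {xs = divisors n} e∈Q
  ...   | e∈D , Qe = ∈-divisors⁻ {n = n} e∈D , Qe , p∤e

module _ {p} (pp : Prime p) {Q Q′ : Pred ℕ 0ℓ} (Q? : Decidable Q) (Q′? : Decidable Q′)
         (Q⇔Q′ : ∀ {e} → .{{NonZero e}} → p ∤ e → Q e ⇔ Q′ (p * e))
         (Q′⇒μ≢0 : ∀ {d} → Q′ d → μ d ≢ 0ℤ) {n} .{{n≢0 : NonZero n}} (p∣n : p ∣ n) where

  private instance
    p≢0 : NonZero p
    p≢0 = prime⇒nonZero pp

  p*-p-free↭ : map (p *_) (p-free p Q? n) ↭ filter (p ∣?_) (divisorsWith Q′? n)
  p*-p-free↭ = ∼bag⇒↭ (unique∧set⇒bag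
    (Unique.map⁺ (*-cancelˡ-≡ _ _ p) (p-free-unique Q? {p = p} {n = n}))
    (Unique.filter⁺ (p ∣?_) (Unique.filter⁺ Q′? (divisors-unique n)))
    (mk⇔ to from))
    where
    to : d ∈ map (p *_) (p-free p Q? n) → d ∈ filter (p ∣?_) (divisorsWith Q′? n)
    to d∈ with ∈-map⁻ (p *_) d∈
    ... | e , e∈ , refl with ∈-p-free⁻ Q? e∈
    ...   | (e≢0 , e∣n) , Qe , p∤e = ∈-filter⁺ (p ∣?_)
      (∈-filter⁺ Q′? (∈-divisors⁺ {{n≢0}} {{m*n≢0 p e {{p≢0}} {{e≢0}}}} (p*e∣n pp p∣n e∣n p∤e))
                     (Equivalence.to (Q⇔Q′ {{e≢0}} p∤e) Qe))
      (m∣m*n e)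

    from : d ∈ filter (p ∣?_) (divisorsWith Q′? n) → d ∈ map (p *_) (p-free p Q? n)
    from d∈ with ∈-filter⁻ (p ∣?_) {xs = divisorsWith Q′? n} d∈
    ... | d∈Q′ , divides c refl with ∈-filter⁻ Q′? {xs = divisors n} d∈Q′
    ...   | d∈D , Q′d with ∈-divisors⁻ {n = n} d∈D
    ...     | d≢0 , d∣n = subst (_∈ map (p *_) (p-free p Q? n)) (*-comm p c)
      (∈-map⁺ (p *_) (∈-p-free⁺ Q? {{n≢0}} {{c≢0}} (∣-trans (m∣m*n p) d∣n) Qc p∤c))
      where
      c≢0 : NonZero c
      c≢0 = m*n≢0⇒m≢0 c {{d≢0}}
      p∤c : p ∤ c
      p∤c p∣c = Q′⇒μ≢0 Q′d (μ-square pp {{d≢0}} (*-monoˡ-∣ p p∣c))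
      Qc : Q c
      Qc = Equivalence.from (Q⇔Q′ {{c≢0}} p∤c) (subst Q′ (*-comm c p) Q′d)

module _ {k : ℤ} where

  ∣0ℤ : k ∣ℤ 0ℤ
  ∣0ℤ = S.divides 0ℤ (sym (ℤ.*-zeroˡ k))

  ∣-sub-sym : ∀ {x y} → k ∣ℤ x ℤ.- y → k ∣ℤ y ℤ.- x
  ∣-sub-sym {x} {y} k∣x-y = subst (k ∣ℤ_) (negate x y) (S.∣m⇒∣-m k∣x-y)
    where
    negate : ∀ x y → - (x ℤ.- y) ≡ y ℤ.- x
    negate = solve-∀

  ∣-sub-* : ∀ {x x′ y y′} → k ∣ℤ x ℤ.- x′ → k ∣ℤ y ℤ.- y′ → k ∣ℤ x ℤ.* y ℤ.- x′ ℤ.* y′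
  ∣-sub-* {x} {x′} {y} {y′} k∣x-x′ k∣y-y′ =
    subst (k ∣ℤ_) (sym (expand x x′ y y′)) (S.∣m∣n⇒∣m+n (S.∣m⇒∣m*n y k∣x-x′) (S.∣n⇒∣m*n x′ k∣y-y′))
    where
    expand : ∀ x x′ y y′ → x ℤ.* y ℤ.- x′ ℤ.* y′ ≡ (x ℤ.- x′) ℤ.* y ℤ.+ x′ ℤ.* (y ℤ.- y′)
    expand = solve-∀

module _ {a} {A : Set a} {k : ℤ} where

  ∣-sum : ∀ (g : A → ℤ) xs → (∀ {x} → x ∈ xs → k ∣ℤ g x) → k ∣ℤ sumℤ (map g xs)
  ∣-sum g []       _    = ∣0ℤ
  ∣-sum g (x ∷ xs) k∣gx = S.∣m∣n⇒∣m+n (k∣gx (here refl)) (∣-sum g xs (k∣gx ∘′ there))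

  ∣-sum-except : ∀ (g : A → ℤ) {x xs} → Unique xs → x ∈ xs →
                 (∀ {y} → y ∈ xs → y ≢ x → k ∣ℤ g y) → k ∣ℤ sumℤ (map g xs) → k ∣ℤ g x
  ∣-sum-except g (x∉ ∷ _) (here refl) k∣gy k∣Σ =
    S.∣m+n∣n⇒∣m k∣Σ (∣-sum g _ λ y∈ → k∣gy (there y∈) λ { refl → All.lookup x∉ y∈ refl })
  ∣-sum-except g (y∉ ∷ u) (there x∈) k∣gy k∣Σ =
    ∣-sum-except g u x∈ (k∣gy ∘′ there) (S.∣m+n∣m⇒∣n k∣Σ (k∣gy (here refl) λ { refl → All.lookup y∉ x∈ refl }))

  ∣-sub-product : ∀ (f g : A → ℤ) xs → (∀ {x} → x ∈ xs → k ∣ℤ f x ℤ.- g x) →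
                  k ∣ℤ productℤ (map f xs) ℤ.- productℤ (map g xs)
  ∣-sub-product f g []       _       = ∣0ℤ
  ∣-sub-product f g (x ∷ xs) k∣fx-gx =
    ∣-sub-* {x = f x} {g x} {productℤ (map f xs)} {productℤ (map g xs)}
      (k∣fx-gx (here refl)) (∣-sub-product f g xs (k∣fx-gx ∘′ there))

-- Gauss sequences

module _ {a : ℕ → ℤ} (gauss : IsGauss a) {p : ℕ} (pp : Prime p) where

  private
    instance
      p≢0 : NonZero p
      p≢0 = prime⇒nonZero pp

    p∤1 : p ∤ 1
    p∤1 p∣1 = ¬prime[1] (subst Prime (∣1⇒≡1 p∣1) pp)

    μ≢0? : Decidable (λ d → μ d ≢ 0ℤ)
    μ≢0? = ∁? (λ d → μ d ℤ.≟ 0ℤ)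

    μ≢0⇔ : .{{NonZero e}} → p ∤ e → μ e ≢ 0ℤ ⇔ μ (p * e) ≢ 0ℤ
    μ≢0⇔ p∤e = mk⇔ (λ μe≢0 → μe≢0 ∘′ Equivalence.from (μ-p*-≡ pp p∤e 0ℤ))
                   (λ μpe≢0 → μpe≢0 ∘′ Equivalence.to (μ-p*-≡ pp p∤e 0ℤ))

    μ≡⇒μ≢0 : ∀ {s} → s ≢ 0ℤ → μ d ≡ s → μ d ≢ 0ℤ
    μ≡⇒μ≢0 s≢0 μ≡s μ≡0 = s≢0 (trans (sym μ≡s) μ≡0)

  gauss-congruence : ∀ k {N} .{{_ : NonZero N}} → p ^ k ∣ N → a N ≡ a (N div p) [mod p ^ k ]
  gauss-congruence zero          _ = 1∣ _
  gauss-congruence (suc k) {N} = go (<-wellFounded N)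
    where
    go : ∀ {N} → Acc _<_ N → .{{NonZero N}} → p ^ suc k ∣ N → a N ≡ a (N div p) [mod p ^ suc k ]
    go {N} (acc rs) {{N≢0}} pᵏ⁺¹∣N = S.∣⇒∣ᵤ (subst (+ p ^ suc k ∣ℤ_) h1≡ pᵏ⁺¹∣h1)
      where
      g h : ℕ → ℤ
      g d = μ d ℤ.* a (N div d)
      h e = g (p * e) ℤ.+ g e

      X = p-free p μ≢0? N

      Σg≡Σh : sumℤ (map g (divisors N)) ≡ sumℤ (map h X)
      Σg≡Σh = begin
        sumℤ (map g (divisors N))
          ≡⟨ Sumℤ.fold-filter-ε (λ d → μ d ℤ.≟ 0ℤ) g (divisors N) (λ {d} → cong (ℤ._* a (N div d))) ⟨
        sumℤ (map g (divisorsWith μ≢0? N))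
          ≡⟨ Sumℤ.fold-partition-reindex (p ∣?_) g (p *_) (divisorsWith μ≢0? N) X
               (p*-p-free↭ pp μ≢0? μ≢0? μ≢0⇔ id (m*n∣⇒m∣ p (p ^ k) pᵏ⁺¹∣N)) ⟩
        sumℤ (map (g ∘′ (p *_)) X) ℤ.+ sumℤ (map g X)
          ≡⟨ Sumℤ.fold-map-∙ (g ∘′ (p *_)) g X ⟨
        sumℤ (map h X)
          ∎
        where open ≡-Reasoning

      pᵏ⁺¹∣Σh : + p ^ suc k ∣ℤ sumℤ (map h X)
      pᵏ⁺¹∣Σh = subst (+ p ^ suc k ∣ℤ_) Σg≡Σh (S.∣-trans (S.∣ᵤ⇒∣ {+ p ^ suc k} {+ N} pᵏ⁺¹∣N) N∣Σg)
        where
        Σg = sumℤ (map g (divisors N))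
        N∣Σg : + N ∣ℤ Σg
        N∣Σg = subst (+ N ∣ℤ_) (ℤ.+-identityʳ Σg) (S.∣ᵤ⇒∣ {+ N} {Σg ℤ.- 0ℤ} (gauss N (>-nonZero⁻¹ N)))

      h≡ : .{{NonZero e}} → p ∤ e → h e ≡ μ e ℤ.* (a (N div e) ℤ.- a (N div (p * e)))
      h≡ {e} p∤e = trans (cong (λ s → s ℤ.* a (N div (p * e)) ℤ.+ g e) (μ-p* pp p∤e))
                         (pairing (μ e) (a (N div e)) (a (N div (p * e))))
        where
        pairing : ∀ s x y → (- s) ℤ.* y ℤ.+ s ℤ.* x ≡ s ℤ.* (x ℤ.- y)
        pairing = solve-∀

      pᵏ⁺¹∣h : e ∈ X → e ≢ 1 → + p ^ suc k ∣ℤ h e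
      pᵏ⁺¹∣h {e} e∈X e≢1 with ∈-p-free⁻ μ≢0? e∈X
      ... | (e≢0 , e∣N) , _ , p∤e = subst (+ p ^ suc k ∣ℤ_) (sym (h≡ {{e≢0}} p∤e))
        (S.∣n⇒∣m*n (μ e) (S.∣ᵤ⇒∣ {+ p ^ suc k} {a (N div e) ℤ.- a (N div (p * e))}
          (subst (λ x → a (N div e) ≡ a x [mod p ^ suc k ]) (div-div N e p {{e≢0}})
            (go (rs (div-< {{N≢0}} {{e≢0}} e≢1)) {{div-nonZero {{N≢0}} {{e≢0}} e∣N}}
                (primePower-∣-div (suc k) {{e≢0}} pp p∤e e∣N pᵏ⁺¹∣N)))))

      pᵏ⁺¹∣h1 : + p ^ suc k ∣ℤ h 1
      pᵏ⁺¹∣h1 = ∣-sum-except h (p-free-unique μ≢0? {p = p} {n = N}) (∈-p-free⁺ μ≢0? (1∣ N) (λ ()) p∤1) pᵏ⁺¹∣h pᵏ⁺¹∣Σh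

      h1≡ : h 1 ≡ a N ℤ.- a (N div p)
      h1≡ = begin
        h 1                                        ≡⟨ h≡ p∤1 ⟩
        1ℤ ℤ.* (a (N div 1) ℤ.- a (N div (p * 1))) ≡⟨ ℤ.*-identityˡ _ ⟩
        a (N div 1) ℤ.- a (N div (p * 1))          ≡⟨ cong₂ (λ x y → a x ℤ.- a y) (n/1≡n N) (cong (N div_) (*-identityʳ p)) ⟩
        a N ℤ.- a (N div p)                        ∎
        where open ≡-Reasoning

  eulerGauss-primePower : ∀ k {n} .{{_ : NonZero n}} → p ^ k ∣ n → Aplus a n ≡ Aminus a n [mod p ^ k ]
  eulerGauss-primePower zero          _ = 1∣ _
  eulerGauss-primePower (suc k) {n} {{n≢0}} pᵏ⁺¹∣n =
    S.∣⇒∣ᵤ (subst (+ p ^ suc k ∣ℤ_) (cong₂ ℤ._-_ (sym Aplus≡) (sym Aminus≡))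
      (∣-sub-* {x = Π⁻ₚ} {Π⁻} {Π⁺} {Π⁺ₚ}
        (∣-sub-sym {x = Π⁻} {Π⁻ₚ} (∣-sub-product a[n/_] (a[n/_] ∘′ (p *_)) X⁻ (pᵏ⁺¹∣a[n/e]-a[n/pe] μ≡-1?)))
        (∣-sub-product a[n/_] (a[n/_] ∘′ (p *_)) X⁺ (pᵏ⁺¹∣a[n/e]-a[n/pe] μ≡1?))))
    where
    a[n/_] : ℕ → ℤ
    a[n/ d ] = a (n div d)

    μ≡1? : Decidable (λ d → μ d ≡ 1ℤ)
    μ≡1? d = μ d ℤ.≟ 1ℤ

    μ≡-1? : Decidable (λ d → μ d ≡ - 1ℤ)
    μ≡-1? d = μ d ℤ.≟ - 1ℤ

    X⁺ = p-free p μ≡1? n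
    X⁻ = p-free p μ≡-1? n
    p∣n = m*n∣⇒m∣ p (p ^ k) pᵏ⁺¹∣n

    Π⁺ Π⁺ₚ Π⁻ Π⁻ₚ : ℤ
    Π⁺  = productℤ (map a[n/_] X⁺)
    Π⁺ₚ = productℤ (map (a[n/_] ∘′ (p *_)) X⁺)
    Π⁻  = productℤ (map a[n/_] X⁻)
    Π⁻ₚ = productℤ (map (a[n/_] ∘′ (p *_)) X⁻)

    Aplus≡ : Aplus a n ≡ Π⁻ₚ ℤ.* Π⁺
    Aplus≡ = Productℤ.fold-partition-reindex (p ∣?_) a[n/_] (p *_) (divisorsWith μ≡1? n) X⁻
      (p*-p-free↭ pp μ≡-1? μ≡1? (λ p∤e → μ-p*-≡ pp p∤e (- 1ℤ)) (λ {d} → μ≡⇒μ≢0 {d} λ ()) p∣n)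

    Aminus≡ : Aminus a n ≡ Π⁻ ℤ.* Π⁺ₚ
    Aminus≡ = trans (Productℤ.fold-partition-reindex (p ∣?_) a[n/_] (p *_) (divisorsWith μ≡-1? n) X⁺
                      (p*-p-free↭ pp μ≡1? μ≡-1? (λ p∤e → μ-p*-≡ pp p∤e 1ℤ) (λ {d} → μ≡⇒μ≢0 {d} λ ()) p∣n))
                    (ℤ.*-comm Π⁺ₚ Π⁻)

    pᵏ⁺¹∣a[n/e]-a[n/pe] : ∀ {Q : Pred ℕ 0ℓ} (Q? : Decidable Q) {e} → e ∈ p-free p Q? n →
                          + p ^ suc k ∣ℤ a[n/ e ] ℤ.- a[n/ p * e ]
    pᵏ⁺¹∣a[n/e]-a[n/pe] Q? {e} e∈ with ∈-p-free⁻ Q? e∈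
    ... | (e≢0 , e∣n) , _ , p∤e = S.∣ᵤ⇒∣ {+ p ^ suc k} {a[n/ e ] ℤ.- a[n/ p * e ]}
      (subst (λ x → a (n div e) ≡ a x [mod p ^ suc k ]) (div-div n e p {{e≢0}})
        (gauss-congruence (suc k) {{div-nonZero {{n≢0}} {{e≢0}} e∣n}}
          (primePower-∣-div (suc k) {{e≢0}} pp p∤e e∣n pᵏ⁺¹∣n)))

-- Divisibility is detected by prime powers

primePower-split : Prime p → ∀ n .{{_ : NonZero n}} → Σ ℕ λ j → Σ ℕ λ r → n ≡ p ^ j * r × p ∤ r
primePower-split {p} pp n = go (<-wellFounded n)
  where
  go : ∀ {n} → Acc _<_ n → .{{NonZero n}} → Σ ℕ λ j → Σ ℕ λ r → n ≡ p ^ j * r × p ∤ r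
  go {n} (acc rs) with p ∣? n
  ... | no p∤n = 0 , n , sym (*-identityˡ n) , p∤n
  ... | yes (divides c refl) with go (rs (m<m*n c p {{c≢0}} (prime≥2 pp))) {{c≢0}}
    where
    c≢0 : NonZero c
    c≢0 = m*n≢0⇒m≢0 c
  ...   | j , r , refl , p∤r = suc j , r , ℕ*.xy∙z≈zx∙y (p ^ j) r p , p∤r

primePower-coprime-∣ : Prime p → p ∤ r → ∀ j → p ^ j ∣ m → r ∣ m → p ^ j * r ∣ m
primePower-coprime-∣ {p} {r} pp p∤r j pʲ∣m (divides t refl) =
  *-monoˡ-∣ r (primePower-divisor pp p∤r j (subst (p ^ j ∣_) (*-comm t r) pʲ∣m))

primePowers-∣⇒∣ : ∀ n .{{_ : NonZero n}} → (∀ {p} k → Prime p → p ^ k ∣ n → p ^ k ∣ m) → n ∣ m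
primePowers-∣⇒∣ {m} n = go (<-wellFounded n)
  where
  go : ∀ {n} → Acc _<_ n → .{{NonZero n}} → (∀ {p} k → Prime p → p ^ k ∣ n → p ^ k ∣ m) → n ∣ m
  go {1} _ _ = 1∣ m
  go {n@(2+ _)} (acc rs) pᵏ∣m with leastDivisor-exists {n} (s≤s (s≤s z≤n))
  ... | q , ld with primePower-split (leastDivisor⇒prime ld) n
  ...   | j , r , n≡qʲr , q∤r = subst (_∣ m) (sym n≡qʲr)
    (primePower-coprime-∣ qp q∤r j (pᵏ∣m j qp (subst (q ^ j ∣_) (sym n≡qʲr) (m∣m*n r)))
      (go (rs r<n) {{r≢0}} λ k pp pᵏ∣r → pᵏ∣m k pp (∣-trans pᵏ∣r r∣n)))
    where
    qp = leastDivisor⇒prime ld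
    r∣n : r ∣ n
    r∣n = subst (r ∣_) (sym n≡qʲr) (n∣m*n (q ^ j))
    r≢0 : NonZero r
    r≢0 = m*n≢0⇒n≢0 (q ^ j) {{subst NonZero n≡qʲr _}}
    r<n : r < n
    r<n = ≤∧≢⇒< (∣⇒≤ r∣n) λ { refl → q∤r (LeastDivisor.q∣n ld) }

theorem1 : (a : ℕ → ℤ) → IsGauss a → IsEulerGauss a
theorem1 a gauss n 1≤n = primePowers-∣⇒∣ n λ k pp pᵏ∣n → eulerGauss-primePower {a} gauss pp k pᵏ∣n
  where
  instance
    n≢0 : NonZero n
    n≢0 = >-nonZero 1≤n
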